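{- Let $\mathsf{C}$ be a category with an initial object $0$ and $(T,\mu,\eta)$ a monad on $\mathsf{C}$ such that every hom-set of $\mathcal{K}l(T)$ is a complete join-semilattice and Kleisli composition preserves all non-empty joins in each argument. Assume $\perp=\perp\cdot f^\sharp$ for every $f:X\to Y$ in $\mathsf{C}$. For $\alpha:X\multimap X$ let $\alpha^{*}=\bigvee_{n\ge 0}\alpha^{n}$ and $\mathrm{tr}_\alpha=\mu x.(x\cdot\alpha)=\bigvee_{n\in\mathbb{N}}\perp\cdot\alpha^{n}:X\multimap 0$. Then (1) every strong bisimulation on the $T$-coalgebra $\alpha:X\to TX$ is a weak bisimulation on $\alpha$, and (2) $\mathrm{tr}_\alpha=\mathrm{tr}_{\alpha^{*}}$.
   Context: $\mathcal{K}l(T)$: objects of $\mathsf{C}$, morphisms $X\multimap Y$ are $\mathsf{C}$-morphisms $X\to TY$, composition $g\cdot f=\mu_Z\circ Tg\circ f$, identities $1_X=\eta_X$, $\alpha^0=1_X$; $f^\sharp=\eta_Y\circ f$. $\perp$ denotes the least element of a hom-set. A (strong) bisimulation on a $T$-coalgebra $\alpha:X\to TX$ is a kernel bisimulation: a jointly monic span $X\xleftarrow{\pi_1}R\xrightarrow{\pi_2}X$ such that there exist a $T$-coalgebra $\gamma:Z\to TZ$ and two coalgebra homomorphisms $f,g$ from $\alpha$ to $\gamma$ (i.e. $Tf\circ\alpha=\gamma\circ f$, $Tg\circ\alpha=\gamma\circ g$) with $(R,\pi_1,\pi_2)$ the pullback of $X\xrightarrow{f}Z\xleftarrow{g}X$.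 A weak bisimulation on $\alpha$ is a bisimulation on the saturated coalgebra $\alpha^*:X\to TX$. -}

module Defs where

open import Level using (Level; _⊔_) renaming (suc to lsuc)
open import Data.Nat using (ℕ; zero; suc)
open import Data.Product using (Σ; ∃; _×_; _,_)
open import Data.Empty.Polymorphic using (⊥)
open import Relation.Binary.PropositionalEquality using (_≡_)

record Category (o ℓ : Level) : Set (lsuc (o ⊔ ℓ)) where
  infixr 9 _∘_
  field
    Obj : Set o
    Hom : Obj → Obj → Set ℓ
    id  : ∀ {A} → Hom A A
    _∘_ : ∀ {A B C} → Hom B C → Hom A B → Hom A C
    identityˡ : ∀ {A B} {f : Hom A B} → id ∘ f ≡ f
    identityʳ : ∀ {A B} {f : Hom A B} → f ∘ id ≡ f
    assoc : ∀ {A B C D} {f : Hom A B} {g : Hom B C} {h : Hom C D} →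
            (h ∘ g) ∘ f ≡ h ∘ (g ∘ f)

module _ {o ℓ : Level} (C : Category o ℓ) where
  open Category C

  IsInitial : Obj → Set (o ⊔ ℓ)
  IsInitial O = ∀ A → Σ (Hom O A) λ u → ∀ (v : Hom O A) → v ≡ u

  record Monad : Set (o ⊔ ℓ) where
    field
      T₀ : Obj → Obj
      T₁ : ∀ {A B} → Hom A B → Hom (T₀ A) (T₀ B)
      T-id : ∀ {A} → T₁ (id {A}) ≡ id
      T-∘  : ∀ {A B D} {f : Hom A B} {g : Hom B D} → T₁ (g ∘ f) ≡ T₁ g ∘ T₁ f
      η : ∀ A → Hom A (T₀ A)
      μ : ∀ A → Hom (T₀ (T₀ A)) (T₀ A)
      η-natural : ∀ {A B} (f : Hom A B) → η B ∘ f ≡ T₁ f ∘ η A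
      μ-natural : ∀ {A B} (f : Hom A B) → μ B ∘ T₁ (T₁ f) ≡ T₁ f ∘ μ A
      μ-assoc  : ∀ {A} → μ A ∘ T₁ (μ A) ≡ μ A ∘ μ (T₀ A)
      μ-unitˡ  : ∀ {A} → μ A ∘ T₁ (η A) ≡ id
      μ-unitʳ  : ∀ {A} → μ A ∘ η (T₀ A) ≡ id

  JointlyMonic : ∀ {R X Y} → Hom R X → Hom R Y → Set (o ⊔ ℓ)
  JointlyMonic {R} π₁ π₂ =
    ∀ {W} (u v : Hom W R) → π₁ ∘ u ≡ π₁ ∘ v → π₂ ∘ u ≡ π₂ ∘ v → u ≡ v

  IsPullback : ∀ {X Y Z R} → Hom X Z → Hom Y Z → Hom R X → Hom R Y → Set (o ⊔ ℓ)
  IsPullback {X} {Y} {Z} {R} f g π₁ π₂ =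
    (f ∘ π₁ ≡ g ∘ π₂) ×
    (∀ {W} (p : Hom W X) (q : Hom W Y) → f ∘ p ≡ g ∘ q →
       Σ (Hom W R) λ u → (π₁ ∘ u ≡ p) × (π₂ ∘ u ≡ q) ×
         (∀ (v : Hom W R) → π₁ ∘ v ≡ p → π₂ ∘ v ≡ q → v ≡ u))

record CompleteJoinSemilattice {ℓ : Level} (A : Set ℓ) : Set (lsuc ℓ) where
  infix 4 _≤_
  field
    _≤_ : A → A → Set ℓ
    ≤-refl    : ∀ {a} → a ≤ a
    ≤-trans   : ∀ {a b c} → a ≤ b → b ≤ c → a ≤ c
    ≤-antisym : ∀ {a b} → a ≤ b → b ≤ a → a ≡ b
    ⋁ : (A → Set ℓ) → A
    ⋁-upper : ∀ (P : A → Set ℓ) {a} → P a → a ≤ ⋁ P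
    ⋁-least : ∀ (P : A → Set ℓ) {b} → (∀ a → P a → a ≤ b) → ⋁ P ≤ b

module Kleisli {o ℓ : Level} (C : Category o ℓ) (M : Monad C) where
  open Category C
  open Monad M

  _⇸_ : Obj → Obj → Set ℓ
  X ⇸ Y = Hom X (T₀ Y)

  infixr 9 _·_
  _·_ : ∀ {X Y Z} → Y ⇸ Z → X ⇸ Y → X ⇸ Z
  _·_ {Z = Z} g f = μ Z ∘ T₁ g ∘ f

  idK : ∀ {X} → X ⇸ X
  idK {X} = η X

  _♯ : ∀ {X Y} → Hom X Y → X ⇸ Y
  _♯ {Y = Y} f = η Y ∘ f

  _^_ : ∀ {X} → X ⇸ X → ℕ → X ⇸ X
  α ^ zero  = idK
  α ^ suc n = α · (α ^ n)

  IsCoalgHom : ∀ {X Z} → Hom X (T₀ X) → Hom Z (T₀ Z) → Hom X Z → Set ℓ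
  IsCoalgHom α γ f = T₁ f ∘ α ≡ γ ∘ f

  IsBisimulation : ∀ {X R} → Hom X (T₀ X) → Hom R X → Hom R X → Set (o ⊔ ℓ)
  IsBisimulation {X} α π₁ π₂ =
    JointlyMonic C π₁ π₂ ×
    Σ Obj λ Z → Σ (Hom Z (T₀ Z)) λ γ → Σ (Hom X Z) λ f → Σ (Hom X Z) λ g →
      IsCoalgHom α γ f × IsCoalgHom α γ g × IsPullback C f g π₁ π₂

  record KleisliJoins : Set (o ⊔ lsuc ℓ) where
    field
      cjsl : ∀ X Y → CompleteJoinSemilattice (X ⇸ Y)

    ⋁ : ∀ {X Y} → (X ⇸ Y → Set ℓ) → X ⇸ Y
    ⋁ {X} {Y} = CompleteJoinSemilattice.⋁ (cjsl X Y)

    field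
      ·-preserves-⋁ˡ : ∀ {X Y Z} (g : Y ⇸ Z) (P : X ⇸ Y → Set ℓ) → ∃ P →
        g · ⋁ P ≡ ⋁ (λ h → ∃ λ f → P f × (h ≡ g · f))
      ·-preserves-⋁ʳ : ∀ {X Y Z} (P : Y ⇸ Z → Set ℓ) (f : X ⇸ Y) → ∃ P →
        ⋁ P · f ≡ ⋁ (λ h → ∃ λ g → P g × (h ≡ g · f))

    ⊥K : ∀ {X Y} → X ⇸ Y
    ⊥K = ⋁ (λ _ → ⊥)

    _* : ∀ {X} → X ⇸ X → X ⇸ X
    α * = ⋁ (λ h → ∃ λ n → h ≡ α ^ n)

    tr : (O : Obj) → ∀ {X} → X ⇸ X → X ⇸ O
    tr O α = ⋁ (λ h → ∃ λ n → h ≡ ⊥K · (α ^ n))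

-- Saturation commutes with coalgebra homomorphisms: if f♯ · α = γ · f♯ then
-- f♯ · αⁿ = γⁿ · f♯ for all n, and joins pass through Kleisli composition, so
-- f♯ · α* = γ* · f♯. Hence a kernel bisimulation for α, witnessed by γ, is one
-- for α* witnessed by γ*. For traces, ⊥ · α* = tr_α, and tr_α · α* ≤ tr_α since
-- tr_α · αᵐ is the join of the ⊥ · αⁿ⁺ᵐ; iterating, every ⊥ · (α*)ⁿ lies below
-- tr_α, while ⊥ · (α*)¹ = tr_α gives the other inequality.
module Submission where

open import Defs
open import Level using (Level)
open import Data.Product using (_×_; _,_; ∃)
open import Data.Sum using (_⊎_; inj₁; inj₂)
open import Data.Nat using (ℕ; zero; suc; _+_)
open import Relation.Binary.PropositionalEquality
open ≡-Reasoning

module KleisliLaws {o ℓ : Level} (C : Category o ℓ) (M : Monad C) where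
  open Category C
  open Monad M
  open Kleisli C M

  ·-assoc : ∀ {W X Y Z} (h : Y ⇸ Z) (g : X ⇸ Y) (f : W ⇸ X) → (h · g) · f ≡ h · (g · f)
  ·-assoc {Y = Y} {Z} h g f = begin
      μ Z ∘ (T₁ (μ Z ∘ (T₁ h ∘ g)) ∘ f)
    ≡⟨ cong (λ x → μ Z ∘ (x ∘ f)) (trans T-∘ (cong (T₁ (μ Z) ∘_) T-∘)) ⟩
      μ Z ∘ ((T₁ (μ Z) ∘ (T₁ (T₁ h) ∘ T₁ g)) ∘ f)
    ≡⟨ cong (μ Z ∘_) (trans assoc (cong (T₁ (μ Z) ∘_) assoc)) ⟩
      μ Z ∘ (T₁ (μ Z) ∘ (T₁ (T₁ h) ∘ (T₁ g ∘ f)))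
    ≡⟨ sym assoc ⟩
      (μ Z ∘ T₁ (μ Z)) ∘ (T₁ (T₁ h) ∘ (T₁ g ∘ f))
    ≡⟨ cong (_∘ (T₁ (T₁ h) ∘ (T₁ g ∘ f))) μ-assoc ⟩
      (μ Z ∘ μ (T₀ Z)) ∘ (T₁ (T₁ h) ∘ (T₁ g ∘ f))
    ≡⟨ trans assoc (cong (μ Z ∘_) (sym assoc)) ⟩
      μ Z ∘ ((μ (T₀ Z) ∘ T₁ (T₁ h)) ∘ (T₁ g ∘ f))
    ≡⟨ cong (λ x → μ Z ∘ (x ∘ (T₁ g ∘ f))) (μ-natural h) ⟩
      μ Z ∘ ((T₁ h ∘ μ Y) ∘ (T₁ g ∘ f))
    ≡⟨ cong (μ Z ∘_) assoc ⟩
      μ Z ∘ (T₁ h ∘ (μ Y ∘ (T₁ g ∘ f)))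
    ∎

  ·-identityˡ : ∀ {X Y} (f : X ⇸ Y) → idK · f ≡ f
  ·-identityˡ {Y = Y} f = begin
      μ Y ∘ (T₁ (η Y) ∘ f)  ≡⟨ sym assoc ⟩
      (μ Y ∘ T₁ (η Y)) ∘ f  ≡⟨ cong (_∘ f) μ-unitˡ ⟩
      id ∘ f                ≡⟨ identityˡ ⟩
      f                     ∎

  ·-identityʳ : ∀ {X Y} (f : X ⇸ Y) → f · idK ≡ f
  ·-identityʳ {X} {Y} f = begin
      μ Y ∘ (T₁ f ∘ η X)    ≡⟨ cong (μ Y ∘_) (sym (η-natural f)) ⟩
      μ Y ∘ (η (T₀ Y) ∘ f)  ≡⟨ sym assoc ⟩
      (μ Y ∘ η (T₀ Y)) ∘ f  ≡⟨ cong (_∘ f) μ-unitʳ ⟩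
      id ∘ f                ≡⟨ identityˡ ⟩
      f                     ∎

  ♯-· : ∀ {X Y Z} (f : Hom Y Z) (α : X ⇸ Y) → (f ♯) · α ≡ T₁ f ∘ α
  ♯-· {Z = Z} f α = begin
      μ Z ∘ (T₁ (η Z ∘ f) ∘ α)        ≡⟨ cong (λ x → μ Z ∘ (x ∘ α)) T-∘ ⟩
      μ Z ∘ ((T₁ (η Z) ∘ T₁ f) ∘ α)   ≡⟨ trans (cong (μ Z ∘_) assoc) (sym assoc) ⟩
      (μ Z ∘ T₁ (η Z)) ∘ (T₁ f ∘ α)   ≡⟨ cong (_∘ (T₁ f ∘ α)) μ-unitˡ ⟩
      id ∘ (T₁ f ∘ α)                 ≡⟨ identityˡ ⟩
      T₁ f ∘ α                        ∎

  ·-♯ : ∀ {X Y Z} (γ : Y ⇸ Z) (f : Hom X Y) → γ · (f ♯) ≡ γ ∘ f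
  ·-♯ {Y = Y} {Z} γ f = begin
      μ Z ∘ (T₁ γ ∘ (η Y ∘ f))    ≡⟨ cong (μ Z ∘_) (sym assoc) ⟩
      μ Z ∘ ((T₁ γ ∘ η Y) ∘ f)    ≡⟨ cong (λ x → μ Z ∘ (x ∘ f)) (sym (η-natural γ)) ⟩
      μ Z ∘ ((η (T₀ Z) ∘ γ) ∘ f)  ≡⟨ trans (cong (μ Z ∘_) assoc) (sym assoc) ⟩
      (μ Z ∘ η (T₀ Z)) ∘ (γ ∘ f)  ≡⟨ cong (_∘ (γ ∘ f)) μ-unitʳ ⟩
      id ∘ (γ ∘ f)                ≡⟨ identityˡ ⟩
      γ ∘ f                       ∎

  ^-+ : ∀ {X} (α : X ⇸ X) m n → (α ^ m) · (α ^ n) ≡ α ^ (m + n)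
  ^-+ α zero    n = ·-identityˡ (α ^ n)
  ^-+ α (suc m) n = trans (·-assoc α (α ^ m) (α ^ n)) (cong (α ·_) (^-+ α m n))

  ^-commute : ∀ {X Z} {α : X ⇸ X} {γ : Z ⇸ Z} {f : X ⇸ Z} →
    f · α ≡ γ · f → ∀ n → f · (α ^ n) ≡ (γ ^ n) · f
  ^-commute {f = f} _ zero = trans (·-identityʳ f) (sym (·-identityˡ f))
  ^-commute {α = α} {γ} {f} comm (suc n) = begin
      f · (α · (α ^ n))    ≡⟨ sym (·-assoc f α (α ^ n)) ⟩
      (f · α) · (α ^ n)    ≡⟨ cong (_· (α ^ n)) comm ⟩
      (γ · f) · (α ^ n)    ≡⟨ ·-assoc γ f (α ^ n) ⟩
      γ · (f · (α ^ n))    ≡⟨ cong (γ ·_) (^-commute comm n) ⟩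
      γ · ((γ ^ n) · f)    ≡⟨ sym (·-assoc γ (γ ^ n) f) ⟩
      (γ · (γ ^ n)) · f    ∎

module KleisliJoinLaws {o ℓ : Level} (C : Category o ℓ) (M : Monad C)
                       (J : Kleisli.KleisliJoins C M) where
  open Category C
  open Monad M using (T₁)
  open Kleisli C M
  open KleisliJoins J
  open KleisliLaws C M
  module Lattice {X Y : Obj} = CompleteJoinSemilattice (cjsl X Y)
  open Lattice using (_≤_; ≤-refl; ≤-trans; ≤-antisym; ⋁-upper; ⋁-least)

  ≤-reflexive : ∀ {X Y} {a b : X ⇸ Y} → a ≡ b → a ≤ b
  ≤-reflexive refl = ≤-refl

  -- Both α * and tr O α are joins of this form, definitionally.
  ⨆ : ∀ {X Y} → (ℕ → X ⇸ Y) → X ⇸ Y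
  ⨆ F = ⋁ (λ h → ∃ λ n → h ≡ F n)

  ⨆-upper : ∀ {X Y} (F : ℕ → X ⇸ Y) n → F n ≤ ⨆ F
  ⨆-upper F n = ⋁-upper _ (n , refl)

  ⨆-least : ∀ {X Y} (F : ℕ → X ⇸ Y) {b} → (∀ n → F n ≤ b) → ⨆ F ≤ b
  ⨆-least F F≤b = ⋁-least _ λ { _ (n , refl) → F≤b n }

  ·-⨆ : ∀ {X Y Z} (g : Y ⇸ Z) (F : ℕ → X ⇸ Y) → g · ⨆ F ≡ ⨆ (λ n → g · F n)
  ·-⨆ g F = trans (·-preserves-⋁ˡ g _ (F 0 , 0 , refl)) (≤-antisym
    (⋁-least _ λ { _ (_ , (n , refl) , refl) → ⨆-upper (λ n → g · F n) n })
    (⨆-least _ λ n → ⋁-upper _ (F n , (n , refl) , refl)))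

  ⨆-· : ∀ {X Y Z} (F : ℕ → Y ⇸ Z) (f : X ⇸ Y) → ⨆ F · f ≡ ⨆ (λ n → F n · f)
  ⨆-· F f = trans (·-preserves-⋁ʳ _ f (F 0 , 0 , refl)) (≤-antisym
    (⋁-least _ λ { _ (_ , (n , refl) , refl) → ⨆-upper (λ n → F n · f) n })
    (⨆-least _ λ n → ⋁-upper _ (F n , (n , refl) , refl)))

  ⨆-cong : ∀ {X Y} {F G : ℕ → X ⇸ Y} → (∀ n → F n ≡ G n) → ⨆ F ≡ ⨆ G
  ⨆-cong F≡G = ≤-antisym
    (⨆-least _ λ n → ≤-trans (≤-reflexive (F≡G n)) (⨆-upper _ n))
    (⨆-least _ λ n → ≤-trans (≤-reflexive (sym (F≡G n))) (⨆-upper _ n))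

  ⋁-pair : ∀ {X Y} {a b : X ⇸ Y} → a ≤ b → ⋁ (λ h → (h ≡ a) ⊎ (h ≡ b)) ≡ b
  ⋁-pair a≤b = ≤-antisym
    (⋁-least _ λ { _ (inj₁ refl) → a≤b ; _ (inj₂ refl) → ≤-refl })
    (⋁-upper _ (inj₂ refl))

  -- Monotonicity is the case of the two-element join {a, b} with a ≤ b.
  ·-monoˡ : ∀ {X Y Z} (f : X ⇸ Y) {a b : Y ⇸ Z} → a ≤ b → a · f ≤ b · f
  ·-monoˡ f {a} {b} a≤b = subst (a · f ≤_) join≡b·f (⋁-upper _ (a , inj₁ refl , refl))
    where
    join≡b·f : ⋁ (λ h → ∃ λ g → ((g ≡ a) ⊎ (g ≡ b)) × (h ≡ g · f)) ≡ b · f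
    join≡b·f = trans (sym (·-preserves-⋁ʳ _ f (b , inj₂ refl))) (cong (_· f) (⋁-pair a≤b))

  ^-postfixed : ∀ {X Y} {t : X ⇸ Y} {β : X ⇸ X} → t · β ≤ t → ∀ n → t · (β ^ n) ≤ t
  ^-postfixed {t = t} _ zero = ≤-reflexive (·-identityʳ t)
  ^-postfixed {t = t} {β} t·β≤t (suc n) =
    ≤-trans (≤-reflexive (sym (·-assoc t β (β ^ n))))
            (≤-trans (·-monoˡ (β ^ n) t·β≤t) (^-postfixed t·β≤t n))

  *-preserves-coalgebra-hom : ∀ {X Z} {α : X ⇸ X} {γ : Z ⇸ Z} {f : Hom X Z} →
    IsCoalgHom α γ f → IsCoalgHom (α *) (γ *) f
  *-preserves-coalgebra-hom {α = α} {γ} {f} hom = begin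
      T₁ f ∘ (α *)                      ≡⟨ sym (♯-· f (α *)) ⟩
      (f ♯) · ⨆ (α ^_)                  ≡⟨ ·-⨆ (f ♯) (α ^_) ⟩
      ⨆ (λ n → (f ♯) · (α ^ n))         ≡⟨ ⨆-cong (^-commute ♯-commute) ⟩
      ⨆ (λ n → (γ ^ n) · (f ♯))         ≡⟨ sym (⨆-· (γ ^_) (f ♯)) ⟩
      ⨆ (γ ^_) · (f ♯)                  ≡⟨ ·-♯ (γ *) f ⟩
      (γ *) ∘ f                         ∎
    where
    ♯-commute : (f ♯) · α ≡ γ · (f ♯)
    ♯-commute = trans (♯-· f α) (trans hom (sym (·-♯ γ f)))

  bisimulation⇒weak-bisimulation : ∀ {X R} (α : X ⇸ X) (π₁ π₂ : Hom R X) →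
    IsBisimulation α π₁ π₂ → IsBisimulation (α *) π₁ π₂
  bisimulation⇒weak-bisimulation _ _ _ (monic , Z , γ , f , g , f-hom , g-hom , pullback) =
    monic , Z , γ * , f , g ,
    *-preserves-coalgebra-hom f-hom , *-preserves-coalgebra-hom g-hom , pullback

  module _ (O : Obj) {X : Obj} (α : X ⇸ X) where

    ⊥-·-* : ⊥K · (α *) ≡ tr O α
    ⊥-·-* = ·-⨆ ⊥K (α ^_)

    tr-·-^ : ∀ m → tr O α · (α ^ m) ≤ tr O α
    tr-·-^ m = ≤-trans (≤-reflexive (⨆-· _ (α ^ m))) (⨆-least _ λ n →
      ≤-trans (≤-reflexive (trans (·-assoc ⊥K (α ^ n) (α ^ m)) (cong (⊥K ·_) (^-+ α n m))))
              (⨆-upper _ (n + m)))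

    tr-·-* : tr O α · (α *) ≤ tr O α
    tr-·-* = ≤-trans (≤-reflexive (·-⨆ (tr O α) (α ^_))) (⨆-least _ tr-·-^)

    ⊥-·-*^ : ∀ n → ⊥K · ((α *) ^ n) ≤ tr O α
    ⊥-·-*^ zero = ≤-trans (≤-reflexive (·-identityʳ ⊥K)) (⋁-least _ λ _ ())
    ⊥-·-*^ (suc n) = ≤-trans
      (≤-reflexive (trans (sym (·-assoc ⊥K (α *) ((α *) ^ n))) (cong (_· ((α *) ^ n)) ⊥-·-*)))
      (^-postfixed tr-·-* n)

    tr-* : tr O α ≡ tr O (α *)
    tr-* = ≤-antisym
      (≤-trans (≤-reflexive (sym (trans (cong (⊥K ·_) (·-identityʳ (α *))) ⊥-·-*)))
               (⨆-upper _ 1))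
      (⨆-least _ ⊥-·-*^)

theorem12 : ∀ {o ℓ : Level} (C : Category o ℓ) (O : Category.Obj C) → IsInitial C O →
    (M : Monad C) (J : Kleisli.KleisliJoins C M) →
    let open Category C
        open Kleisli C M
        open KleisliJoins J
    in (∀ {X Y Z} (f : Hom X Y) → ⊥K {X} {Z} ≡ ⊥K {Y} {Z} · (f ♯)) →
       (∀ {X R} (α : X ⇸ X) (π₁ π₂ : Hom R X) →
          IsBisimulation α π₁ π₂ → IsBisimulation (α *) π₁ π₂)
       × (∀ {X} (α : X ⇸ X) → tr O α ≡ tr O (α *))
theorem12 C O _ M J _ =
  KleisliJoinLaws.bisimulation⇒weak-bisimulation C M J , KleisliJoinLaws.tr-* C M J O
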